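{- Let $s,t$ be positive integers and $r=s+4$. Let $T^{r}_{s,t}$ be the tree with vertex set $\{v_0,v_1,v_2,v_3,v_4\}\cup\{p_1,\ldots,p_s\}\cup\{q_1,\ldots,q_s\}\cup\{w_1,\ldots,w_t\}$ (all distinct) and edge set $\{v_0v_1,v_1v_2,v_2v_3,v_3v_4\}\cup\{p_iq_i: 1\le i\le s\}\cup\{v_2w_i:1\le i\le t\}\cup\{v_2p_i:1\le i\le s\}$. Then $\gamma(T^{r}_{s,t})=\nu_2(T^{r}_{s,t})-1$.
   Context: For a graph $G$, $\gamma(G)$ is the domination number: the minimum size of a set $D\subseteq V(G)$ such that every vertex is in $D$ or adjacent to a vertex of $D$. A 2-packing is a set $R\subseteq E(G)$ such that no three edges of $R$ are incident with a common vertex; $\nu_2(G)$ is the maximum size of a 2-packing. -}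

module Defs where

open import Data.Nat using (ℕ; _+_; _≤_)
open import Data.Fin using (Fin; _↑ʳ_; _↑ˡ_; _≟_)
open import Data.Fin.Subset using (Subset; _∈_; _∩_; ∣_∣)
open import Data.List using (List; []; _∷_; _++_; map; allFin; length; lookup)
open import Data.Vec using (tabulate)
open import Data.Bool using (_∨_)
open import Data.Product using (Σ; _×_; _,_; proj₁; proj₂)
open import Data.Sum using (_⊎_)
open import Relation.Binary.PropositionalEquality using (_≡_)
open import Relation.Nullary.Decidable using (⌊_⌋)

-- A (finite, simple) graph on vertex set Fin n, given by its list of edges,
-- each edge listed once as an (unordered) pair of endpoints.
record Graph : Set where
  field
    n : ℕ
    edges : List (Fin n × Fin n)

open Graph public

EdgeIx : Graph → Set
EdgeIx G = Fin (length (edges G))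

endpoints : (G : Graph) → EdgeIx G → Fin (n G) × Fin (n G)
endpoints G e = lookup (edges G) e

Adj : (G : Graph) → Fin (n G) → Fin (n G) → Set
Adj G u v = Σ (EdgeIx G) λ e → (endpoints G e ≡ (u , v)) ⊎ (endpoints G e ≡ (v , u))

IsDominating : (G : Graph) → Subset (n G) → Set
IsDominating G D = ∀ v → (v ∈ D) ⊎ (Σ (Fin (n G)) λ u → (u ∈ D) × Adj G u v)

IsDominationNumber : Graph → ℕ → Set
IsDominationNumber G k =
  (Σ (Subset (n G)) λ D → IsDominating G D × ∣ D ∣ ≡ k)
  × (∀ D → IsDominating G D → k ≤ ∣ D ∣)

incidentEdges : (G : Graph) → Fin (n G) → Subset (length (edges G))
incidentEdges G v = tabulate λ e →
  ⌊ proj₁ (endpoints G e) ≟ v ⌋ ∨ ⌊ proj₂ (endpoints G e) ≟ v ⌋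

Is2Packing : (G : Graph) → Subset (length (edges G)) → Set
Is2Packing G R = ∀ v → ∣ R ∩ incidentEdges G v ∣ ≤ 2

Is2PackingNumber : Graph → ℕ → Set
Is2PackingNumber G k =
  (Σ (Subset (length (edges G))) λ R → Is2Packing G R × ∣ R ∣ ≡ k)
  × (∀ R → Is2Packing G R → ∣ R ∣ ≤ k)

-- The tree T^{s+4}_{s,t}.  Vertices: v0..v4 are 0..4, then p_1..p_s,
-- then q_1..q_s, then w_1..w_t.
module Tree (s t : ℕ) where
  N : ℕ
  N = 5 + (s + (s + t))

  vv : Fin 5 → Fin N
  vv i = i ↑ˡ (s + (s + t))

  p : Fin s → Fin N
  p i = 5 ↑ʳ (i ↑ˡ (s + t))

  q : Fin s → Fin N
  q i = 5 ↑ʳ (s ↑ʳ (i ↑ˡ t))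

  w : Fin t → Fin N
  w i = 5 ↑ʳ (s ↑ʳ (s ↑ʳ i))

  v0 v1 v2 v3 v4 : Fin N
  v0 = vv (# 0) where open import Data.Fin using (#_)
  v1 = vv (# 1) where open import Data.Fin using (#_)
  v2 = vv (# 2) where open import Data.Fin using (#_)
  v3 = vv (# 3) where open import Data.Fin using (#_)
  v4 = vv (# 4) where open import Data.Fin using (#_)

  E : List (Fin N × Fin N)
  E = (v0 , v1) ∷ (v1 , v2) ∷ (v2 , v3) ∷ (v3 , v4)
      ∷ (map (λ i → (p i , q i)) (allFin s)
         ++ map (λ i → (v2 , w i)) (allFin t)
         ++ map (λ i → (v2 , p i)) (allFin s))

  T : Graph
  T = record { n = N ; edges = E }

T[_,_] : ℕ → ℕ → Graph
T[ s , t ] = Tree.T s t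

module Submission where

-- A dominating set meets each of the pairwise disjoint sets {v₀,v₁}, {v₃,v₄}, {v₂} ∪ W and
-- {pᵢ,qᵢ} (this uses t ≥ 1), so γ ≥ s + 3, and {v₁,v₂,v₃,p₁,…,pₛ} dominates. A 2-packing has at
-- most two edges at v₂ and only the s + 2 edges v₀v₁, v₃v₄, pᵢqᵢ avoid v₂, so ν₂ ≤ s + 4, which
-- the path v₀v₁v₂v₃v₄ together with the matching {pᵢqᵢ} attains.

open import Defs
open import Data.Nat using (ℕ; zero; suc; _+_; _≤_; _∸_; z≤n; s≤s)
open import Data.Nat.Properties
  using (+-assoc; +-suc; +-identityʳ; +-monoʳ-≤; +-mono-≤; ≤-refl; ≤-reflexive; ≤-trans; m≤m+n; m≤n+m; n≤1+n; module ≤-Reasoning)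
open import Data.Nat.Solver using (module +-*-Solver)
open import Data.Product using (Σ; ∃-syntax; _×_; _,_; proj₁; proj₂)
open import Data.Sum as Sum using (_⊎_; inj₁; inj₂; [_,_]′)
open import Data.Bool using (Bool; true; false; T; not; _∧_; _∨_)
open import Data.Bool.Properties using (T-∨)
open import Data.Fin using (Fin; zero; suc; _↑ˡ_; _↑ʳ_; splitAt; fromℕ<; _≟_)
open import Data.Fin.Properties using (0≢1+n; suc-injective; splitAt-↑ˡ; splitAt-↑ʳ; splitAt⁻¹-↑ˡ; splitAt⁻¹-↑ʳ)
open import Data.Fin.Subset using (Subset; inside; outside; _∈_; _∩_; ∁; ∣_∣; ⊤; ⊥)
open import Data.Fin.Subset.Properties using (drop-there; ∈⊤; ∣⊤∣≡n; ∣⊥∣≡0; ∣p∣≤∣x∷p∣; x∈p⇒∣p-x∣<∣p∣)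
open import Data.Vec as V using ([]; _∷_; here; there)
open import Data.Vec.Properties using (tabulate-∘)
open import Data.List as L using (List; []; _∷_; _++_; map; allFin; length)
open import Data.List.Properties using (map-tabulate)
open import Data.List.Membership.Propositional using () renaming (_∈_ to _∈ₗ_)
import Data.List.Membership.Propositional.Properties as ∈ₗ
open import Data.List.Relation.Unary.Any as Any using (here; there)
open import Data.List.Relation.Unary.Any.Properties using (lookup-index)
open import Function using (_∘_; id)
open import Function.Bundles using (Equivalence)
open import Relation.Binary.PropositionalEquality using (_≡_; refl; sym; trans; cong; cong₂; subst; module ≡-Reasoning)
open import Relation.Nullary using (¬_; contradiction)
open import Relation.Nullary.Decidable using (⌊_⌋; toWitness)

indicator : Bool → ℕ
indicator true  = 1
indicator false = 0

countᵇ : {A : Set} → (A → Bool) → List A → ℕ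
countᵇ f []       = 0
countᵇ f (x ∷ xs) = indicator (f x) + countᵇ f xs

module _ {A : Set} (f : A → Bool) where

  countᵇ-++ : ∀ xs ys → countᵇ f (xs ++ ys) ≡ countᵇ f xs + countᵇ f ys
  countᵇ-++ []       ys = refl
  countᵇ-++ (x ∷ xs) ys = trans (cong (indicator (f x) +_) (countᵇ-++ xs ys)) (sym (+-assoc (indicator (f x)) _ _))

  countᵇ-tabulate-none : ∀ {m} (g : Fin m → A) → (∀ i → ¬ T (f (g i))) → countᵇ f (L.tabulate g) ≡ 0
  countᵇ-tabulate-none {zero}  g none = refl
  countᵇ-tabulate-none {suc m} g none with f (g zero) | none zero
  ... | false | _  = countᵇ-tabulate-none (g ∘ suc) (none ∘ suc)
  ... | true  | ¬t = contradiction _ ¬t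

  countᵇ-tabulate-all : ∀ {m} (g : Fin m → A) → (∀ i → T (f (g i))) → countᵇ f (L.tabulate g) ≡ m
  countᵇ-tabulate-all {zero}  g all = refl
  countᵇ-tabulate-all {suc m} g all with f (g zero) | all zero
  ... | true  | _  = cong suc (countᵇ-tabulate-all (g ∘ suc) (all ∘ suc))
  ... | false | ()

  countᵇ-tabulate-≤1 : ∀ {m} (g : Fin m → A) → (∀ i j → T (f (g i)) → T (f (g j)) → i ≡ j) →
                       countᵇ f (L.tabulate g) ≤ 1
  countᵇ-tabulate-≤1 {zero}  g unique = z≤n
  countᵇ-tabulate-≤1 {suc m} g unique with f (g zero) in eq
  ... | false = countᵇ-tabulate-≤1 (g ∘ suc) (λ i j ti tj → suc-injective (unique (suc i) (suc j) ti tj))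
  ... | true  = s≤s (≤-reflexive (countᵇ-tabulate-none (g ∘ suc)
                  (λ i ti → 0≢1+n (unique zero (suc i) (subst T (sym eq) _) ti))))

∣tabulate∘lookup∣≡countᵇ : {A : Set} (f : A → Bool) (xs : List A) →
                           ∣ V.tabulate (f ∘ L.lookup xs) ∣ ≡ countᵇ f xs
∣tabulate∘lookup∣≡countᵇ f []       = refl
∣tabulate∘lookup∣≡countᵇ f (x ∷ xs) with f x
... | true  = cong suc (∣tabulate∘lookup∣≡countᵇ f xs)
... | false = ∣tabulate∘lookup∣≡countᵇ f xs

tabulate-∩ : ∀ {m} (f g : Fin m → Bool) → V.tabulate f ∩ V.tabulate g ≡ V.tabulate (λ i → f i ∧ g i)
tabulate-∩ {zero}  f g = refl
tabulate-∩ {suc m} f g = cong (f zero ∧ g zero ∷_) (tabulate-∩ (f ∘ suc) (g ∘ suc))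

∣p++q∣≡∣p∣+∣q∣ : ∀ {m n} (p : Subset m) (q : Subset n) → ∣ p V.++ q ∣ ≡ ∣ p ∣ + ∣ q ∣
∣p++q∣≡∣p∣+∣q∣ []            q = refl
∣p++q∣≡∣p∣+∣q∣ (inside  ∷ p) q = cong suc (∣p++q∣≡∣p∣+∣q∣ p q)
∣p++q∣≡∣p∣+∣q∣ (outside ∷ p) q = ∣p++q∣≡∣p∣+∣q∣ p q

∣p∣≤∣p∩q∣+∣∁q∣ : ∀ {m} (p q : Subset m) → ∣ p ∣ ≤ ∣ p ∩ q ∣ + ∣ ∁ q ∣
∣p∣≤∣p∩q∣+∣∁q∣ []            []            = z≤n
∣p∣≤∣p∩q∣+∣∁q∣ (inside  ∷ p) (inside  ∷ q) = s≤s (∣p∣≤∣p∩q∣+∣∁q∣ p q)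
∣p∣≤∣p∩q∣+∣∁q∣ (inside  ∷ p) (outside ∷ q) rewrite +-suc ∣ p ∩ q ∣ ∣ ∁ q ∣ = s≤s (∣p∣≤∣p∩q∣+∣∁q∣ p q)
∣p∣≤∣p∩q∣+∣∁q∣ (outside ∷ p) (inside  ∷ q) = ∣p∣≤∣p∩q∣+∣∁q∣ p q
∣p∣≤∣p∩q∣+∣∁q∣ (outside ∷ p) (outside ∷ q) = ≤-trans (∣p∣≤∣p∩q∣+∣∁q∣ p q) (+-monoʳ-≤ ∣ p ∩ q ∣ (n≤1+n ∣ ∁ q ∣))

x∈p⇒0<∣p∣ : ∀ {m} {x : Fin m} {p : Subset m} → x ∈ p → 1 ≤ ∣ p ∣
x∈p⇒0<∣p∣ x∈p = ≤-trans (s≤s z≤n) (x∈p⇒∣p-x∣<∣p∣ x∈p)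

covering⇒n≤∣p∣+∣q∣ : ∀ {m} (p q : Subset m) → (∀ i → i ∈ p ⊎ i ∈ q) → m ≤ ∣ p ∣ + ∣ q ∣
covering⇒n≤∣p∣+∣q∣ []            []      cover = z≤n
covering⇒n≤∣p∣+∣q∣ (inside  ∷ p) (y ∷ q) cover =
  s≤s (≤-trans (covering⇒n≤∣p∣+∣q∣ p q (λ i → Sum.map drop-there drop-there (cover (suc i))))
               (+-monoʳ-≤ ∣ p ∣ (∣p∣≤∣x∷p∣ y q)))
covering⇒n≤∣p∣+∣q∣ (outside ∷ p) (inside  ∷ q) cover rewrite +-suc ∣ p ∣ ∣ q ∣ =
  s≤s (covering⇒n≤∣p∣+∣q∣ p q (λ i → Sum.map drop-there drop-there (cover (suc i))))
covering⇒n≤∣p∣+∣q∣ (outside ∷ p) (outside ∷ q) cover with cover zero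
... | inj₁ ()
... | inj₂ ()

∈-++⁺ˡ : ∀ {m n} {p : Subset m} {q : Subset n} {i} → i ∈ p → (i ↑ˡ n) ∈ p V.++ q
∈-++⁺ˡ here      = here
∈-++⁺ˡ (there m) = there (∈-++⁺ˡ m)

∈-++⁺ʳ : ∀ {m n} (p : Subset m) {q : Subset n} {i} → i ∈ q → (m ↑ʳ i) ∈ p V.++ q
∈-++⁺ʳ []      i∈q = i∈q
∈-++⁺ʳ (x ∷ p) i∈q = there (∈-++⁺ʳ p i∈q)

∈-++⁻ˡ : ∀ {m n} (p : Subset m) (q : Subset n) {i} → (i ↑ˡ n) ∈ p V.++ q → i ∈ p
∈-++⁻ˡ (x ∷ p) q {i = zero}  here      = here
∈-++⁻ˡ (x ∷ p) q {i = suc i} (there m) = there (∈-++⁻ˡ p q m)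

∈-++⁻ʳ : ∀ {m n} (p : Subset m) (q : Subset n) {i} → (m ↑ʳ i) ∈ p V.++ q → i ∈ q
∈-++⁻ʳ []      q i∈q       = i∈q
∈-++⁻ʳ (x ∷ p) q (there m) = ∈-++⁻ʳ p q m

incident : ∀ {m} → Fin m → Fin m × Fin m → Bool
incident x e = ⌊ proj₁ e ≟ x ⌋ ∨ ⌊ proj₂ e ≟ x ⌋

edgesWhere : (G : Graph) → (Fin (n G) × Fin (n G) → Bool) → Subset (length (edges G))
edgesWhere G f = V.tabulate (f ∘ endpoints G)

∣edgesWhere∣ : ∀ G f → ∣ edgesWhere G f ∣ ≡ countᵇ f (edges G)
∣edgesWhere∣ G f = ∣tabulate∘lookup∣≡countᵇ f (edges G)

edgesWhere∩incidentEdges : ∀ G f x →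
  edgesWhere G f ∩ incidentEdges G x ≡ edgesWhere G (λ e → f e ∧ incident x e)
edgesWhere∩incidentEdges G f x = tabulate-∩ _ _

2packing⇒∣R∣≤2+avoiding : ∀ G R → Is2Packing G R → ∀ x →
  ∣ R ∣ ≤ 2 + countᵇ (not ∘ incident x) (edges G)
2packing⇒∣R∣≤2+avoiding G R packing x = begin
  ∣ R ∣                                    ≤⟨ ∣p∣≤∣p∩q∣+∣∁q∣ R (incidentEdges G x) ⟩
  ∣ R ∩ incidentEdges G x ∣ + ∣ ∁ (incidentEdges G x) ∣ ≤⟨ +-mono-≤ (packing x) ≤-refl ⟩
  2 + ∣ ∁ (incidentEdges G x) ∣            ≡⟨ cong (λ S → 2 + ∣ S ∣) (sym (tabulate-∘ not (incident x ∘ endpoints G))) ⟩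
  2 + ∣ edgesWhere G (not ∘ incident x) ∣  ≡⟨ cong (2 +_) (∣edgesWhere∣ G _) ⟩
  2 + countᵇ (not ∘ incident x) (edges G)  ∎
  where open ≤-Reasoning

module TreeProperties (s t : ℕ) where
  private module Tr = Tree s t
  open Tr using (N; E)

  data Vertex : Set where
    v     : Fin 5 → Vertex
    p q   : Fin s → Vertex
    w     : Fin t → Vertex

  pattern v₀ = v zero
  pattern v₁ = v (suc zero)
  pattern v₂ = v (suc (suc zero))
  pattern v₃ = v (suc (suc (suc zero)))
  pattern v₄ = v (suc (suc (suc (suc zero))))

  ⟦_⟧ : Vertex → Fin N
  ⟦ v k ⟧ = Tr.vv k
  ⟦ p i ⟧ = Tr.p i
  ⟦ q i ⟧ = Tr.q i
  ⟦ w i ⟧ = Tr.w i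

  decode : Fin N → Vertex
  decode x = [ v , [ p , [ q , w ]′ ∘ splitAt s ]′ ∘ splitAt s ]′ (splitAt 5 x)

  decode-⟦⟧ : ∀ a → decode ⟦ a ⟧ ≡ a
  decode-⟦⟧ (v k) rewrite splitAt-↑ˡ 5 k (s + (s + t)) = refl
  decode-⟦⟧ (p i) rewrite splitAt-↑ˡ s i (s + t) = refl
  decode-⟦⟧ (q i) rewrite splitAt-↑ʳ s (s + t) (i ↑ˡ t) | splitAt-↑ˡ s i t = refl
  decode-⟦⟧ (w i) rewrite splitAt-↑ʳ s (s + t) (s ↑ʳ i) | splitAt-↑ʳ s t i = refl

  ⟦decode⟧ : ∀ x → ⟦ decode x ⟧ ≡ x
  ⟦decode⟧ x with splitAt 5 x in eq₅
  ... | inj₁ k = splitAt⁻¹-↑ˡ eq₅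
  ... | inj₂ y with splitAt s y in eqₚ
  ... | inj₁ i = trans (cong (5 ↑ʳ_) (splitAt⁻¹-↑ˡ eqₚ)) (splitAt⁻¹-↑ʳ eq₅)
  ... | inj₂ z with splitAt s z in eq_q
  ... | inj₁ i = trans (cong (λ u → 5 ↑ʳ (s ↑ʳ u)) (splitAt⁻¹-↑ˡ eq_q))
                       (trans (cong (5 ↑ʳ_) (splitAt⁻¹-↑ʳ eqₚ)) (splitAt⁻¹-↑ʳ eq₅))
  ... | inj₂ j = trans (cong (λ u → 5 ↑ʳ (s ↑ʳ u)) (splitAt⁻¹-↑ʳ eq_q))
                       (trans (cong (5 ↑ʳ_) (splitAt⁻¹-↑ʳ eqₚ)) (splitAt⁻¹-↑ʳ eq₅))

  ⟦⟧-injective : ∀ {a b} → ⟦ a ⟧ ≡ ⟦ b ⟧ → a ≡ b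
  ⟦⟧-injective {a} {b} eq = trans (sym (decode-⟦⟧ a)) (trans (cong decode eq) (decode-⟦⟧ b))

  ⟦⟧-surjective : ∀ x → ∃[ a ] ⟦ a ⟧ ≡ x
  ⟦⟧-surjective x = decode x , ⟦decode⟧ x

  data Edge : Vertex → Vertex → Set where
    v₀v₁ : Edge v₀ v₁
    v₁v₂ : Edge v₁ v₂
    v₂v₃ : Edge v₂ v₃
    v₃v₄ : Edge v₃ v₄
    pq   : ∀ i → Edge (p i) (q i)
    v₂w  : ∀ i → Edge v₂ (w i)
    v₂p  : ∀ i → Edge v₂ (p i)

  _~_ : Vertex → Vertex → Set
  a ~ b = Edge a b ⊎ Edge b a

  path : List (Fin N × Fin N)
  path = (⟦ v₀ ⟧ , ⟦ v₁ ⟧) ∷ (⟦ v₁ ⟧ , ⟦ v₂ ⟧) ∷ (⟦ v₂ ⟧ , ⟦ v₃ ⟧) ∷ (⟦ v₃ ⟧ , ⟦ v₄ ⟧) ∷ []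

  matchingEdge spokeEdge : Fin s → Fin N × Fin N
  matchingEdge i = ⟦ p i ⟧ , ⟦ q i ⟧
  spokeEdge    i = ⟦ v₂ ⟧ , ⟦ p i ⟧

  leafEdge : Fin t → Fin N × Fin N
  leafEdge i = ⟦ v₂ ⟧ , ⟦ w i ⟧

  matching leaves spokes : List (Fin N × Fin N)
  matching = map matchingEdge (allFin s)
  leaves   = map leafEdge (allFin t)
  spokes   = map spokeEdge (allFin s)

  Edge⇒∈E : ∀ {a b} → Edge a b → (⟦ a ⟧ , ⟦ b ⟧) ∈ₗ E
  Edge⇒∈E v₀v₁    = here refl
  Edge⇒∈E v₁v₂    = there (here refl)
  Edge⇒∈E v₂v₃    = there (there (here refl))
  Edge⇒∈E v₃v₄    = there (there (there (here refl)))
  Edge⇒∈E (pq i)  = ∈ₗ.∈-++⁺ʳ path (∈ₗ.∈-++⁺ˡ (∈ₗ.∈-map⁺ _ (∈ₗ.∈-allFin i)))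
  Edge⇒∈E (v₂w i) = ∈ₗ.∈-++⁺ʳ path (∈ₗ.∈-++⁺ʳ matching (∈ₗ.∈-++⁺ˡ (∈ₗ.∈-map⁺ _ (∈ₗ.∈-allFin i))))
  Edge⇒∈E (v₂p i) = ∈ₗ.∈-++⁺ʳ path (∈ₗ.∈-++⁺ʳ matching (∈ₗ.∈-++⁺ʳ leaves (∈ₗ.∈-map⁺ _ (∈ₗ.∈-allFin i))))

  Edge-respects-⟦⟧ : ∀ {a b a′ b′} → Edge a′ b′ → (⟦ a ⟧ , ⟦ b ⟧) ≡ (⟦ a′ ⟧ , ⟦ b′ ⟧) → Edge a b
  Edge-respects-⟦⟧ {a} {b} {a′} {b′} e eq with ⟦⟧-injective {a} {a′} (cong proj₁ eq) | ⟦⟧-injective {b} {b′} (cong proj₂ eq)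
  ... | refl | refl = e

  ∈E⇒Edge : ∀ {a b} → (⟦ a ⟧ , ⟦ b ⟧) ∈ₗ E → Edge a b
  ∈E⇒Edge (here eq)                         = Edge-respects-⟦⟧ v₀v₁ eq
  ∈E⇒Edge (there (here eq))                 = Edge-respects-⟦⟧ v₁v₂ eq
  ∈E⇒Edge (there (there (here eq)))         = Edge-respects-⟦⟧ v₂v₃ eq
  ∈E⇒Edge (there (there (there (here eq)))) = Edge-respects-⟦⟧ v₃v₄ eq
  ∈E⇒Edge (there (there (there (there m)))) with ∈ₗ.∈-++⁻ matching m
  ... | inj₁ m′ with ∈ₗ.∈-map⁻ _ m′
  ...   | i , _ , eq = Edge-respects-⟦⟧ (pq i) eq
  ∈E⇒Edge (there (there (there (there m)))) | inj₂ m′ with ∈ₗ.∈-++⁻ leaves m′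
  ... | inj₁ m″ with ∈ₗ.∈-map⁻ _ m″
  ...   | i , _ , eq = Edge-respects-⟦⟧ (v₂w i) eq
  ∈E⇒Edge (there (there (there (there m)))) | inj₂ m′ | inj₂ m″ with ∈ₗ.∈-map⁻ _ m″
  ...   | i , _ , eq = Edge-respects-⟦⟧ (v₂p i) eq

  Edge⇒Adj : ∀ {a b} → a ~ b → Adj T[ s , t ] ⟦ a ⟧ ⟦ b ⟧
  Edge⇒Adj (inj₁ ab) = Any.index (Edge⇒∈E ab) , inj₁ (sym (lookup-index (Edge⇒∈E ab)))
  Edge⇒Adj (inj₂ ba) = Any.index (Edge⇒∈E ba) , inj₂ (sym (lookup-index (Edge⇒∈E ba)))

  Adj⇒Edge : ∀ {a b} → Adj T[ s , t ] ⟦ a ⟧ ⟦ b ⟧ → a ~ b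
  Adj⇒Edge (e , inj₁ eq) = inj₁ (∈E⇒Edge (subst (_∈ₗ E) eq (∈ₗ.∈-lookup e)))
  Adj⇒Edge (e , inj₂ eq) = inj₂ (∈E⇒Edge (subst (_∈ₗ E) eq (∈ₗ.∈-lookup e)))

  D₀ : Subset N
  D₀ = (outside ∷ inside ∷ inside ∷ inside ∷ outside ∷ []) V.++ (⊤ {s} V.++ ⊥ {s + t})

  ∣D₀∣≡3+s : ∣ D₀ ∣ ≡ 3 + s
  ∣D₀∣≡3+s = cong (3 +_) (begin
    ∣ ⊤ {s} V.++ ⊥ {s + t} ∣ ≡⟨ ∣p++q∣≡∣p∣+∣q∣ (⊤ {s}) ⊥ ⟩
    ∣ ⊤ {s} ∣ + ∣ ⊥ {s + t} ∣ ≡⟨ cong₂ _+_ (∣⊤∣≡n s) (∣⊥∣≡0 (s + t)) ⟩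
    s + 0                   ≡⟨ +-identityʳ s ⟩
    s                       ∎)
    where open ≡-Reasoning

  p∈D₀ : ∀ i → ⟦ p i ⟧ ∈ D₀
  p∈D₀ i = ∈-++⁺ʳ (outside ∷ inside ∷ inside ∷ inside ∷ outside ∷ []) (∈-++⁺ˡ ∈⊤)

  D₀-dominates : ∀ a → ⟦ a ⟧ ∈ D₀ ⊎ ∃[ u ] u ∈ D₀ × Adj T[ s , t ] u ⟦ a ⟧
  D₀-dominates v₀    = inj₂ (⟦ v₁ ⟧ , there here , Edge⇒Adj (inj₂ v₀v₁))
  D₀-dominates v₁    = inj₁ (there here)
  D₀-dominates v₂    = inj₁ (there (there here))
  D₀-dominates v₃    = inj₁ (there (there (there here)))
  D₀-dominates v₄    = inj₂ (⟦ v₃ ⟧ , there (there (there here)) , Edge⇒Adj (inj₁ v₃v₄))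
  D₀-dominates (p i) = inj₁ (p∈D₀ i)
  D₀-dominates (q i) = inj₂ (⟦ p i ⟧ , p∈D₀ i , Edge⇒Adj (inj₁ (pq i)))
  D₀-dominates (w i) = inj₂ (⟦ v₂ ⟧ , there (there here) , Edge⇒Adj (inj₁ (v₂w i)))

  D₀-dominating : IsDominating T[ s , t ] D₀
  D₀-dominating x with ⟦⟧-surjective x
  ... | a , refl = D₀-dominates a

  module _ {D : Subset N} (dominating : IsDominating T[ s , t ] D) where

    dominated : ∀ a → ⟦ a ⟧ ∈ D ⊎ ∃[ b ] b ~ a × ⟦ b ⟧ ∈ D
    dominated a with dominating ⟦ a ⟧
    ... | inj₁ a∈D = inj₁ a∈D
    ... | inj₂ (u , u∈D , adj) with ⟦⟧-surjective u
    ...   | b , refl = inj₂ (b , Adj⇒Edge adj , u∈D)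

    v₀-or-v₁ : ⟦ v₀ ⟧ ∈ D ⊎ ⟦ v₁ ⟧ ∈ D
    v₀-or-v₁ with dominated v₀
    ... | inj₁ v₀∈D                   = inj₁ v₀∈D
    ... | inj₂ (_ , inj₂ v₀v₁ , v₁∈D) = inj₂ v₁∈D

    v₃-or-v₄ : ⟦ v₃ ⟧ ∈ D ⊎ ⟦ v₄ ⟧ ∈ D
    v₃-or-v₄ with dominated v₄
    ... | inj₁ v₄∈D                   = inj₂ v₄∈D
    ... | inj₂ (_ , inj₁ v₃v₄ , v₃∈D) = inj₁ v₃∈D

    v₂-or-w : ∀ j → ⟦ v₂ ⟧ ∈ D ⊎ ⟦ w j ⟧ ∈ D
    v₂-or-w j with dominated (w j)
    ... | inj₁ w∈D                       = inj₂ w∈D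
    ... | inj₂ (_ , inj₁ (v₂w j) , v₂∈D) = inj₁ v₂∈D

    p-or-q : ∀ i → ⟦ p i ⟧ ∈ D ⊎ ⟦ q i ⟧ ∈ D
    p-or-q i with dominated (q i)
    ... | inj₁ q∈D                     = inj₂ q∈D
    ... | inj₂ (_ , inj₁ (pq i) , p∈D) = inj₁ p∈D

  3+s≤∣dominating∣ : Fin t → ∀ D → IsDominating T[ s , t ] D → 3 + s ≤ ∣ D ∣
  3+s≤∣dominating∣ j D dominating with V.splitAt 5 D
  ... | b₀ ∷ b₁ ∷ b₂ ∷ b₃ ∷ b₄ ∷ [] , D′ , refl with V.splitAt s D′
  ...   | dp , D″ , refl with V.splitAt s D″
  ...     | dq , dw , refl = begin
    1 + (1 + (1 + s))                                ≤⟨ +-mono-≤ h₀₁ (+-mono-≤ h₂w (+-mono-≤ h₃₄ hpq)) ⟩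
    ∣ d₀₁ ∣ + ((∣ d₂ ∣ + ∣ dw ∣) + (∣ d₃₄ ∣ + (∣ dp ∣ + ∣ dq ∣))) ≡⟨ regroup (∣ d₀₁ ∣) (∣ d₂ ∣) (∣ d₃₄ ∣) (∣ dp ∣) (∣ dq ∣) (∣ dw ∣) ⟩
    ∣ d₀₁ ∣ + (∣ d₂ ∣ + (∣ d₃₄ ∣ + (∣ dp ∣ + (∣ dq ∣ + ∣ dw ∣)))) ≡⟨ ∣blocks∣ ⟩
    ∣ d₀₁ V.++ (d₂ V.++ (d₃₄ V.++ P)) ∣                ∎
    where
    open ≤-Reasoning
    d₀₁ = b₀ ∷ b₁ ∷ []
    d₂  = b₂ ∷ []
    d₃₄ = b₃ ∷ b₄ ∷ []
    P   = dp V.++ (dq V.++ dw)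

    regroup : ∀ a b c d e f → a + ((b + f) + (c + (d + e))) ≡ a + (b + (c + (d + (e + f))))
    regroup = solve 6 (λ a b c d e f → a :+ ((b :+ f) :+ (c :+ (d :+ e))) := a :+ (b :+ (c :+ (d :+ (e :+ f))))) refl
      where open +-*-Solver

    ∣blocks∣ : ∣ d₀₁ ∣ + (∣ d₂ ∣ + (∣ d₃₄ ∣ + (∣ dp ∣ + (∣ dq ∣ + ∣ dw ∣)))) ≡ ∣ d₀₁ V.++ (d₂ V.++ (d₃₄ V.++ P)) ∣
    ∣blocks∣ = sym (begin-equality
      ∣ d₀₁ V.++ (d₂ V.++ (d₃₄ V.++ P)) ∣      ≡⟨ ∣p++q∣≡∣p∣+∣q∣ d₀₁ (d₂ V.++ (d₃₄ V.++ P)) ⟩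
      ∣ d₀₁ ∣ + ∣ d₂ V.++ (d₃₄ V.++ P) ∣       ≡⟨ cong (∣ d₀₁ ∣ +_) (∣p++q∣≡∣p∣+∣q∣ d₂ (d₃₄ V.++ P)) ⟩
      ∣ d₀₁ ∣ + (∣ d₂ ∣ + ∣ d₃₄ V.++ P ∣)      ≡⟨ cong (λ x → ∣ d₀₁ ∣ + (∣ d₂ ∣ + x)) (∣p++q∣≡∣p∣+∣q∣ d₃₄ P) ⟩
      ∣ d₀₁ ∣ + (∣ d₂ ∣ + (∣ d₃₄ ∣ + ∣ P ∣))   ≡⟨ cong (λ x → ∣ d₀₁ ∣ + (∣ d₂ ∣ + (∣ d₃₄ ∣ + x)))
                                                   (trans (∣p++q∣≡∣p∣+∣q∣ dp (dq V.++ dw)) (cong (∣ dp ∣ +_) (∣p++q∣≡∣p∣+∣q∣ dq dw))) ⟩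
      ∣ d₀₁ ∣ + (∣ d₂ ∣ + (∣ d₃₄ ∣ + (∣ dp ∣ + (∣ dq ∣ + ∣ dw ∣)))) ∎)

    inP : ∀ {i} → (5 ↑ʳ i) ∈ d₀₁ V.++ (d₂ V.++ (d₃₄ V.++ P)) → i ∈ P
    inP = ∈-++⁻ʳ (b₀ ∷ b₁ ∷ b₂ ∷ b₃ ∷ b₄ ∷ []) P

    h₀₁ : 1 ≤ ∣ d₀₁ ∣
    h₀₁ = [ x∈p⇒0<∣p∣ ∘ ∈-++⁻ˡ d₀₁ _ , x∈p⇒0<∣p∣ ∘ ∈-++⁻ˡ d₀₁ _ ]′ (v₀-or-v₁ dominating)

    h₂w : 1 ≤ ∣ d₂ ∣ + ∣ dw ∣
    h₂w = [ (λ v₂∈D → ≤-trans (x∈p⇒0<∣p∣ (∈-++⁻ˡ d₂ _ (∈-++⁻ʳ d₀₁ _ v₂∈D))) (m≤m+n ∣ d₂ ∣ ∣ dw ∣))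
          , (λ w∈D → ≤-trans (x∈p⇒0<∣p∣ (∈-++⁻ʳ dq dw (∈-++⁻ʳ dp _ (inP w∈D)))) (m≤n+m ∣ dw ∣ ∣ d₂ ∣))
          ]′ (v₂-or-w dominating j)

    h₃₄ : 1 ≤ ∣ d₃₄ ∣
    h₃₄ = [ x∈p⇒0<∣p∣ ∘ in₃₄ , x∈p⇒0<∣p∣ ∘ in₃₄ ]′ (v₃-or-v₄ dominating)
      where
      in₃₄ : ∀ {i} → (3 ↑ʳ (i ↑ˡ _)) ∈ d₀₁ V.++ (d₂ V.++ (d₃₄ V.++ P)) → i ∈ d₃₄
      in₃₄ = ∈-++⁻ˡ d₃₄ P ∘ ∈-++⁻ʳ d₂ _ ∘ ∈-++⁻ʳ d₀₁ _

    hpq : s ≤ ∣ dp ∣ + ∣ dq ∣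
    hpq = covering⇒n≤∣p∣+∣q∣ dp dq λ i →
      Sum.map (∈-++⁻ˡ dp _ ∘ inP) (∈-++⁻ˡ dq dw ∘ ∈-++⁻ʳ dp _ ∘ inP) (p-or-q dominating i)

  γ≡3+s : Fin t → IsDominationNumber T[ s , t ] (3 + s)
  γ≡3+s j = (D₀ , D₀-dominating , ∣D₀∣≡3+s) , 3+s≤∣dominating∣ j

  countᵇ-E : ∀ f → (∀ i → ¬ T (f (leafEdge i))) → (∀ i → ¬ T (f (spokeEdge i))) →
             countᵇ f E ≡ countᵇ f path + countᵇ f (L.tabulate matchingEdge)
  countᵇ-E f no-leaf no-spoke = begin
    countᵇ f (path ++ matching ++ leaves ++ spokes)
      ≡⟨ countᵇ-++ f path (matching ++ leaves ++ spokes) ⟩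
    countᵇ f path + countᵇ f (matching ++ leaves ++ spokes)
      ≡⟨ cong (countᵇ f path +_) (countᵇ-++ f matching (leaves ++ spokes)) ⟩
    countᵇ f path + (countᵇ f matching + countᵇ f (leaves ++ spokes))
      ≡⟨ cong (λ x → countᵇ f path + (countᵇ f matching + x)) (countᵇ-++ f leaves spokes) ⟩
    countᵇ f path + (countᵇ f matching + (countᵇ f leaves + countᵇ f spokes))
      ≡⟨ cong (λ x → countᵇ f path + (countᵇ f matching + x))
              (cong₂ _+_ (trans (as-tabulate leafEdge) (countᵇ-tabulate-none f leafEdge no-leaf))
                         (trans (as-tabulate spokeEdge) (countᵇ-tabulate-none f spokeEdge no-spoke))) ⟩
    countᵇ f path + (countᵇ f matching + 0)
      ≡⟨ cong (countᵇ f path +_) (trans (+-identityʳ _) (as-tabulate matchingEdge)) ⟩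
    countᵇ f path + countᵇ f (L.tabulate matchingEdge) ∎
    where
    open ≡-Reasoning
    as-tabulate : ∀ {m} (g : Fin m → Fin N × Fin N) → countᵇ f (map g (allFin m)) ≡ countᵇ f (L.tabulate g)
    as-tabulate g = cong (countᵇ f) (map-tabulate id g)

  avoiding-v₂ : countᵇ (not ∘ incident ⟦ v₂ ⟧) E ≡ 2 + s
  avoiding-v₂ = trans (countᵇ-E f (λ _ ()) (λ _ ())) (cong (2 +_) (countᵇ-tabulate-all f matchingEdge (λ _ → _)))
    where f = not ∘ incident ⟦ v₂ ⟧

  ∣2packing∣≤4+s : ∀ R → Is2Packing T[ s , t ] R → ∣ R ∣ ≤ 4 + s
  ∣2packing∣≤4+s R packing =
    ≤-trans (2packing⇒∣R∣≤2+avoiding T[ s , t ] R packing ⟦ v₂ ⟧) (≤-reflexive (cong (2 +_) avoiding-v₂))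

  -- Every edge except the v₂wᵢ and v₂pᵢ.
  inR₀ : Fin N × Fin N → Bool
  inR₀ (x , y) = not ⌊ x ≟ ⟦ v₂ ⟧ ⌋ ∨ ⌊ y ≟ ⟦ v₃ ⟧ ⌋

  R₀ : Subset (length E)
  R₀ = edgesWhere T[ s , t ] inR₀

  ∣R₀∣≡4+s : ∣ R₀ ∣ ≡ 4 + s
  ∣R₀∣≡4+s = begin
    ∣ R₀ ∣                                                ≡⟨ ∣edgesWhere∣ T[ s , t ] inR₀ ⟩
    countᵇ inR₀ E                                         ≡⟨ countᵇ-E inR₀ (λ _ ()) (λ _ ()) ⟩
    4 + countᵇ inR₀ (L.tabulate matchingEdge)             ≡⟨ cong (4 +_) (countᵇ-tabulate-all inR₀ matchingEdge (λ _ → _)) ⟩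
    4 + s                                                 ∎
    where open ≡-Reasoning

  R₀-at : Fin N → Fin N × Fin N → Bool
  R₀-at x e = inR₀ e ∧ incident x e

  on-matchingEdge : ∀ c i → T (R₀-at ⟦ c ⟧ (matchingEdge i)) → p i ≡ c ⊎ q i ≡ c
  on-matchingEdge c i t =
    Sum.map (⟦⟧-injective ∘ toWitness {a? = ⟦ p i ⟧ ≟ ⟦ c ⟧}) (⟦⟧-injective ∘ toWitness {a? = ⟦ q i ⟧ ≟ ⟦ c ⟧})
            (Equivalence.to T-∨ t)

  matching-degree≤1 : ∀ c → countᵇ (R₀-at ⟦ c ⟧) (L.tabulate matchingEdge) ≤ 1
  matching-degree≤1 c = countᵇ-tabulate-≤1 _ matchingEdge λ i j tᵢ tⱼ →
    same (on-matchingEdge c i tᵢ) (on-matchingEdge c j tⱼ)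
    where
    same : ∀ {i j} → p i ≡ c ⊎ q i ≡ c → p j ≡ c ⊎ q j ≡ c → i ≡ j
    same (inj₁ refl) (inj₁ refl) = refl
    same (inj₂ refl) (inj₂ refl) = refl

  matching-degree-v : ∀ k → countᵇ (R₀-at ⟦ v k ⟧) (L.tabulate matchingEdge) ≡ 0
  matching-degree-v k = countᵇ-tabulate-none _ matchingEdge λ i t → [ (λ ()) , (λ ()) ]′ (on-matchingEdge (v k) i t)

  path-degree-v : ∀ k → countᵇ (R₀-at ⟦ v k ⟧) path ≤ 2
  path-degree-v zero                            = s≤s z≤n
  path-degree-v (suc zero)                      = ≤-refl
  path-degree-v (suc (suc zero))                = ≤-refl
  path-degree-v (suc (suc (suc zero)))          = ≤-refl
  path-degree-v (suc (suc (suc (suc zero))))    = s≤s z≤n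

  R₀-degree≤2 : ∀ {x d e} → countᵇ (R₀-at x) path ≤ d → countᵇ (R₀-at x) (L.tabulate matchingEdge) ≤ e →
                d + e ≤ 2 → countᵇ (R₀-at x) E ≤ 2
  R₀-degree≤2 {x} on-path on-matching d+e≤2 = begin
    countᵇ (R₀-at x) E                                              ≡⟨ countᵇ-E (R₀-at x) (λ _ ()) (λ _ ()) ⟩
    countᵇ (R₀-at x) path + countᵇ (R₀-at x) (L.tabulate matchingEdge) ≤⟨ +-mono-≤ on-path on-matching ⟩
    _                                                               ≤⟨ d+e≤2 ⟩
    2                                                               ∎
    where open ≤-Reasoning

  R₀-degree : ∀ a → countᵇ (R₀-at ⟦ a ⟧) E ≤ 2
  R₀-degree (v k) = R₀-degree≤2 (path-degree-v k) (≤-reflexive (matching-degree-v k)) ≤-refl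
  R₀-degree (p j) = R₀-degree≤2 {d = 0} z≤n (matching-degree≤1 (p j)) (s≤s z≤n)
  R₀-degree (q j) = R₀-degree≤2 {d = 0} z≤n (matching-degree≤1 (q j)) (s≤s z≤n)
  R₀-degree (w j) = R₀-degree≤2 {d = 0} z≤n (matching-degree≤1 (w j)) (s≤s z≤n)

  R₀-2packing : Is2Packing T[ s , t ] R₀
  R₀-2packing x with ⟦⟧-surjective x
  ... | a , refl = begin
    ∣ R₀ ∩ incidentEdges T[ s , t ] ⟦ a ⟧ ∣ ≡⟨ cong ∣_∣ (edgesWhere∩incidentEdges T[ s , t ] inR₀ ⟦ a ⟧) ⟩
    ∣ edgesWhere T[ s , t ] (R₀-at ⟦ a ⟧) ∣ ≡⟨ ∣edgesWhere∣ T[ s , t ] (R₀-at ⟦ a ⟧) ⟩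
    countᵇ (R₀-at ⟦ a ⟧) E                 ≤⟨ R₀-degree a ⟩
    2                                      ∎
    where open ≤-Reasoning

  ν₂≡4+s : Is2PackingNumber T[ s , t ] (4 + s)
  ν₂≡4+s = (R₀ , R₀-2packing , ∣R₀∣≡4+s) , ∣2packing∣≤4+s

theorem2p4 : (s t : ℕ) → 1 ≤ s → 1 ≤ t →
    Σ ℕ λ g → Σ ℕ λ k →
    IsDominationNumber T[ s , t ] g × Is2PackingNumber T[ s , t ] k × (g ≡ k ∸ 1)
theorem2p4 s t _ 1≤t = 3 + s , 4 + s , γ≡3+s (fromℕ< 1≤t) , ν₂≡4+s , refl
  where open TreeProperties s t
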